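{- For every integer $m\geq 3$, the cycle $C_m$ (the connected $2$-regular graph with $m$ vertices) is $2$-approximately magic.
   Context: For a graph with $m$ edges, a labeling is a bijection $f$ from the edge set to $\{1,\ldots,m\}$; the vertex sum at a vertex $v$ is the sum of $f(e)$ over all edges $e$ incident with $v$. A labeling is $\delta$-approximately magic if the difference between the largest and the smallest vertex sums is at most $\delta$. A graph is $\delta$-approximately magic if it admits a $\delta$-approximately magic labeling. -}

module Defs where

open import Data.Nat using (ℕ; zero; suc; _+_; _∸_; _≤_; _≥_)
open import Data.Fin using (Fin; toℕ; _≟_)
open import Data.Fin.Properties using (all?)
open import Data.Product using (_×_; _,_; Σ; ∃; proj₁; proj₂)
open import Data.List using (List; map; filter; allFin)
open import Data.Nat.ListAction using (sum)
open import Data.Sum using (_⊎_)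
open import Relation.Binary.PropositionalEquality using (_≡_)
open import Function.Bundles using (Bijection)
open import Relation.Nullary.Decidable using (_⊎-dec_)

record Graph (n m : ℕ) : Set where
  field
    ends : Fin m → Fin n × Fin n

open Graph public

-- A labeling: bijection from the edge set Fin m to {1,…,m};
-- edge e gets label  toℕ (f e) + 1.
Labeling : ℕ → Set
Labeling m = Bijection (Data.Fin.Properties.≡-setoid m) (Data.Fin.Properties.≡-setoid m)
  where import Data.Fin.Properties

label : ∀ {m} → Labeling m → Fin m → ℕ
label f e = suc (toℕ (Bijection.to f e))

vertexSum : ∀ {n m} → Graph n m → Labeling m → Fin n → ℕ
vertexSum G f v =
  sum (map (label f)
    (filter (λ e → (proj₁ (ends G e) ≟ v) ⊎-dec (proj₂ (ends G e) ≟ v)) (allFin _)))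

IsApproxMagicLabeling : ∀ {n m} → ℕ → Graph n m → Labeling m → Set
IsApproxMagicLabeling δ G f =
  ∀ u v → vertexSum G f u ≤ vertexSum G f v + δ

IsApproxMagic : ∀ {n m} → ℕ → Graph n m → Set
IsApproxMagic δ G = Σ (Labeling _) (IsApproxMagicLabeling δ G)

cycle : (m : ℕ) → Graph m m
cycle zero = record { ends = λ () }
cycle (suc k) = record { ends = λ i → i , next i }
  where
  next : Fin (suc k) → Fin (suc k)
  next i = Data.Fin.fromℕ< (Data.Nat.DivMod.m%n<n (toℕ i + 1) (suc k))
    where import Data.Nat.DivMod

{-# OPTIONS --safe #-}
-- Number the edges of C_m by 0, …, m − 1 along the cycle and pair edge i with its mirror
-- image m − 1 − i, at depth min(i, m − 1 − i). Swapping the two labels of every pair of odd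
-- depth is an involution, hence a labeling. Vertex i + 1 meets the edges i and i + 1, which
-- lie in pairs whose depths differ by one, so exactly one of them is swapped and their
-- 0-based labels add up to m − 2 or m; the exception is i + 1 = m − 1 − i, a single pair,
-- with sum m − 1. Vertex 0 meets the edges 0 and m − 1, again a single pair. So every vertex
-- sum lies in {m, m + 1, m + 2}.
module Submission where

open import Defs
open import Data.Nat using (ℕ; zero; suc; _+_; _∸_; _≤_; _≥_; _⊓_; s≤s; parity)
open import Data.Nat.Properties
  using (1+n≢n; +-comm; +-suc; +-identityʳ; +-monoʳ-≤; ≤-refl; ≤-trans; n≤1+n; m≤n+m;
         n∸n≡0; +-∸-assoc; m+[n∸m]≡n; ⊓-comm; ⊓-zeroʳ; +-0-commutativeMonoid)
open import Data.Nat.ListAction using (sum)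
open import Data.Nat.DivMod using (_%_; n%n≡0; m<n⇒m%n≡m)
open import Data.Parity.Base using (Parity; 0ℙ; 1ℙ; _⁻¹)
open import Data.Parity.Properties using (p≢p⁻¹; suc-homo-⁻¹)
open import Data.Fin using (Fin; zero; suc; toℕ; fromℕ; inject₁; opposite; punchIn; _≟_)
open import Data.Fin.Properties
  using (toℕ-injective; toℕ-fromℕ; toℕ-fromℕ<; toℕ-inject₁; toℕ<n; toℕ≤pred[n];
         opposite-prop; opposite-involutive; punchInᵢ≢i)
open import Data.Fin.Relation.Unary.Top using (view; ‵fromℕ; ‵inject₁)
open import Data.List using (map; filter; tabulate; allFin)
open import Data.Product using (_×_; _,_; proj₁; proj₂)
open import Data.Sum using (_⊎_; inj₁; inj₂; [_,_])
open import Data.Bool using (if_then_else_)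
open import Function using (_∘_; id)
open import Level using (Level)
open import Function.Bundles using (_⇔_; mk⇔; Equivalence; mk↔ₛ′)
open import Function.Properties.Inverse using (↔⇒⤖)
open import Relation.Nullary using (does; yes; no; contradiction)
open import Relation.Nullary.Decidable using (dec-true; dec-false; _⊎-dec_)
open import Relation.Unary using (Pred; Decidable)
open import Relation.Binary.PropositionalEquality
  using (_≡_; _≢_; refl; sym; trans; cong; cong₂; subst; subst₂; module ≡-Reasoning)
open import Algebra.Properties.CommutativeMonoid.Sum +-0-commutativeMonoid
  using (sum-remove; sum-cong-≗; sum-replicate-zero; ∑-distrib-+)
  renaming (sum to ∑)

private
  variable
    A : Set
    ℓ : Level
    k n : ℕ

infix 4 _∈[_,_]
_∈[_,_] : ℕ → ℕ → ℕ → Set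
s ∈[ a , b ] = a ≤ s × s ≤ b

∈[]⇒spread : ∀ {c δ} (s : A → ℕ) → (∀ x → s x ∈[ c , δ + c ]) → ∀ x y → s x ≤ s y + δ
∈[]⇒spread {c = c} {δ} s window x y =
  ≤-trans (proj₂ (window x)) (subst (δ + c ≤_) (+-comm δ (s y)) (+-monoʳ-≤ δ (proj₁ (window y))))

vertexSums-∈[]⇒approxMagic : ∀ {m c δ} (G : Graph n m) (f : Labeling m) →
  (∀ v → vertexSum G f v ∈[ c , δ + c ]) → IsApproxMagicLabeling δ G f
vertexSums-∈[]⇒approxMagic G f window = ∈[]⇒spread (vertexSum G f) window

select : Parity → A → A → A
select 0ℙ x y = x
select 1ℙ x y = y

select-map : ∀ {B : Set} (f : A → B) p {x y} → f (select p x y) ≡ select p (f x) (f y)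
select-map f 0ℙ = refl
select-map f 1ℙ = refl

select-+-swap : ∀ p x y → select p x y + select p y x ≡ x + y
select-+-swap 0ℙ x y = refl
select-+-swap 1ℙ x y = +-comm y x

choose : ℕ → ℕ → ℕ
choose x y = select (parity (x ⊓ y)) x y

choose-+-swap : ∀ x y → choose x y + choose y x ≡ x + y
choose-+-swap x y = begin
  choose x y + select (parity (y ⊓ x)) y x
    ≡⟨ cong (λ d → choose x y + select (parity d) y x) (⊓-comm y x) ⟩
  choose x y + select (parity (x ⊓ y)) y x
    ≡⟨ select-+-swap (parity (x ⊓ y)) x y ⟩
  x + y ∎
  where open ≡-Reasoning

⊓-suc-shift : ∀ x y → x ≡ y ⊎ x ⊓ suc y ≡ suc (suc x ⊓ y) ⊎ suc x ⊓ y ≡ suc (x ⊓ suc y)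
⊓-suc-shift zero    zero    = inj₁ refl
⊓-suc-shift zero    (suc y) = inj₂ (inj₂ refl)
⊓-suc-shift (suc x) zero    = inj₂ (inj₁ (cong suc (⊓-zeroʳ x)))
⊓-suc-shift (suc x) (suc y) with ⊓-suc-shift x y
... | inj₁ x≡y        = inj₁ (cong suc x≡y)
... | inj₂ (inj₁ eq) = inj₂ (inj₁ (cong suc eq))
... | inj₂ (inj₂ eq) = inj₂ (inj₂ (cong suc eq))

parity-suc-≢ : ∀ n → parity (suc n) ≢ parity n
parity-suc-≢ n eq = p≢p⁻¹ (parity n) (trans (sym (suc-homo-⁻¹ n)) (cong _⁻¹ eq))

parity-⊓-suc-shift : ∀ x y → x ≡ y ⊎ parity (x ⊓ suc y) ≢ parity (suc x ⊓ y)
parity-⊓-suc-shift x y with ⊓-suc-shift x y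
... | inj₁ x≡y       = inj₁ x≡y
... | inj₂ (inj₁ eq) = inj₂ λ p≡q →
  parity-suc-≢ (suc x ⊓ y) (trans (cong parity (sym eq)) p≡q)
... | inj₂ (inj₂ eq) = inj₂ λ p≡q →
  parity-suc-≢ (x ⊓ suc y) (trans (cong parity (sym eq)) (sym p≡q))

select-apart : ∀ {p q : Parity} (x y : ℕ) → p ≢ q →
  select p x (suc y) + select q (suc x) y ∈[ x + y , 2 + (x + y) ]
select-apart {0ℙ} {0ℙ} x y p≢q = contradiction refl p≢q
select-apart {0ℙ} {1ℙ} x y _   = ≤-refl , m≤n+m (x + y) 2
select-apart {1ℙ} {0ℙ} x y _   =
  subst (_∈[ x + y , 2 + (x + y) ]) (sym sy+sx≡2+x+y) (m≤n+m (x + y) 2 , ≤-refl)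
  where
  sy+sx≡2+x+y : suc y + suc x ≡ 2 + (x + y)
  sy+sx≡2+x+y = cong suc (trans (+-suc y x) (cong suc (+-comm y x)))
select-apart {1ℙ} {1ℙ} x y p≢q = contradiction refl p≢q

choose-adjacent : ∀ x y → choose x (suc y) + choose (suc x) y ∈[ x + y , 2 + (x + y) ]
choose-adjacent x y with parity-⊓-suc-shift x y
... | inj₂ p≢q = select-apart x y p≢q
... | inj₁ refl = subst (_∈[ x + x , 2 + (x + x) ]) (sym (trans (choose-+-swap x (suc x)) (+-suc x x)))
                    (n≤1+n (x + x) , n≤1+n (suc (x + x)))

mirror : ℕ → ℕ → ℕ
mirror k x = choose x (k ∸ x)

mirror-ends : ∀ k → mirror k k + mirror k 0 ≡ k
mirror-ends k = begin
  choose k (k ∸ k) + choose 0 k ≡⟨ cong (λ z → choose k z + choose 0 k) (n∸n≡0 k) ⟩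
  choose k 0 + choose 0 k       ≡⟨ choose-+-swap k 0 ⟩
  k + 0                         ≡⟨ +-identityʳ k ⟩
  k                             ∎
  where open ≡-Reasoning

mirror-adjacent : ∀ {n x} → x ≤ n → mirror (suc n) x + mirror (suc n) (suc x) ∈[ n , 2 + n ]
mirror-adjacent {n} {x} x≤n =
  subst₂ (λ s c → s ∈[ c , 2 + c ]) unfold-mirror (m+[n∸m]≡n x≤n) (choose-adjacent x (n ∸ x))
  where
  unfold-mirror : choose x (suc (n ∸ x)) + choose (suc x) (n ∸ x) ≡ mirror (suc n) x + mirror (suc n) (suc x)
  unfold-mirror = cong (λ z → choose x z + choose (suc x) (n ∸ x)) (sym (+-∸-assoc 1 x≤n))

depth : Fin n → ℕ
depth i = toℕ i ⊓ toℕ (opposite i)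

depth-opposite : (i : Fin n) → depth (opposite i) ≡ depth i
depth-opposite i = trans (cong (toℕ (opposite i) ⊓_) (cong toℕ (opposite-involutive i))) (⊓-comm _ _)

zigzag : Fin n → Fin n
zigzag i = select (parity (depth i)) i (opposite i)

zigzag-select : ∀ {p} (i : Fin n) → parity (depth i) ≡ p → zigzag i ≡ select p i (opposite i)
zigzag-select i eq = cong (λ p → select p i (opposite i)) eq

zigzag-involutive : (i : Fin n) → zigzag (zigzag i) ≡ i
zigzag-involutive i = by-parity (parity (depth i)) refl
  where
  open ≡-Reasoning
  by-parity : ∀ p → parity (depth i) ≡ p → zigzag (zigzag i) ≡ i
  by-parity 0ℙ eq = trans (cong zigzag (zigzag-select i eq)) (zigzag-select i eq)
  by-parity 1ℙ eq = begin
    zigzag (zigzag i)      ≡⟨ cong zigzag (zigzag-select i eq) ⟩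
    zigzag (opposite i)    ≡⟨ zigzag-select (opposite i) (trans (cong parity (depth-opposite i)) eq) ⟩
    opposite (opposite i)  ≡⟨ opposite-involutive i ⟩
    i                      ∎

toℕ-zigzag : (i : Fin (suc k)) → toℕ (zigzag i) ≡ mirror k (toℕ i)
toℕ-zigzag i = trans (select-map toℕ (parity (depth i))) (cong (choose (toℕ i)) (opposite-prop i))

zigzagLabeling : ∀ m → Labeling m
zigzagLabeling m = ↔⇒⤖ (mk↔ₛ′ zigzag zigzag zigzag-involutive zigzag-involutive)

sum-filter-tabulate : ∀ {P : Pred A ℓ} (P? : Decidable P) (g : A → ℕ) (h : Fin n → A) →
  sum (map g (filter P? (tabulate h))) ≡ ∑ (λ i → if does (P? (h i)) then g (h i) else 0)
sum-filter-tabulate {n = zero}  P? g h = refl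
sum-filter-tabulate {n = suc n} P? g h with P? (h zero)
... | yes _ = cong (g (h zero) +_) (sum-filter-tabulate P? g (h ∘ suc))
... | no _  = sum-filter-tabulate P? g (h ∘ suc)

∑-point : (a : Fin n) (g : Fin n → ℕ) → ∑ (λ i → if does (i ≟ a) then g i else 0) ≡ g a
∑-point {suc n} a g = begin
  ∑ t                          ≡⟨ sum-remove {i = a} t ⟩
  t a + ∑ (t ∘ punchIn a)      ≡⟨ cong₂ _+_ t-at-a (sum-cong-≗ t-off-a) ⟩
  g a + ∑ {n} (λ _ → 0)        ≡⟨ cong (g a +_) (sum-replicate-zero n) ⟩
  g a + 0                      ≡⟨ +-identityʳ (g a) ⟩
  g a                          ∎
  where
  open ≡-Reasoning
  t : Fin (suc n) → ℕ
  t i = if does (i ≟ a) then g i else 0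
  t-at-a : t a ≡ g a
  t-at-a = cong (λ b → if b then g a else 0) (dec-true (a ≟ a) refl)
  t-off-a : ∀ i → t (punchIn a i) ≡ 0
  t-off-a i = cong (λ b → if b then g (punchIn a i) else 0) (dec-false (punchIn a i ≟ a) (punchInᵢ≢i a i))

indicator-pair : ∀ {P : Pred (Fin n) ℓ} (P? : Decidable P) (g : Fin n → ℕ) {a b} →
  a ≢ b → (∀ e → P e ⇔ (e ≡ a ⊎ e ≡ b)) → ∀ e →
  (if does (P? e) then g e else 0) ≡ (if does (e ≟ a) then g e else 0) + (if does (e ≟ b) then g e else 0)
indicator-pair P? g {a} {b} a≢b P⇔ e with e ≟ a | e ≟ b | P? e
... | yes e≡a | yes e≡b | _      = contradiction (trans (sym e≡a) e≡b) a≢b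
... | yes e≡a | _       | no ¬Pe = contradiction (Equivalence.from (P⇔ e) (inj₁ e≡a)) ¬Pe
... | _       | yes e≡b | no ¬Pe = contradiction (Equivalence.from (P⇔ e) (inj₂ e≡b)) ¬Pe
... | no e≢a  | no e≢b  | yes Pe = contradiction (Equivalence.to (P⇔ e) Pe) [ e≢a , e≢b ]
... | yes _   | no _    | yes _  = sym (+-identityʳ (g e))
... | no _    | yes _   | yes _  = refl
... | no _    | no _    | no _   = refl

sum-filter-pair : ∀ {P : Pred (Fin n) ℓ} (P? : Decidable P) (g : Fin n → ℕ) {a b} →
  a ≢ b → (∀ e → P e ⇔ (e ≡ a ⊎ e ≡ b)) → sum (map g (filter P? (allFin n))) ≡ g a + g b
sum-filter-pair P? g {a} {b} a≢b P⇔ = begin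
  sum (map g (filter P? (allFin _)))                  ≡⟨ sum-filter-tabulate P? g id ⟩
  ∑ (λ e → if does (P? e) then g e else 0)             ≡⟨ sum-cong-≗ (indicator-pair P? g a≢b P⇔) ⟩
  ∑ (λ e → point a e + point b e)                      ≡⟨ ∑-distrib-+ (point a) (point b) ⟩
  ∑ (point a) + ∑ (point b)                            ≡⟨ cong₂ _+_ (∑-point a g) (∑-point b g) ⟩
  g a + g b                                            ∎
  where
  open ≡-Reasoning
  point : Fin _ → Fin _ → ℕ
  point c e = if does (e ≟ c) then g e else 0

next : Fin (suc k) → Fin (suc k)
next {k} i = proj₂ (ends (cycle (suc k)) i)

prev : Fin (suc k) → Fin (suc k)
prev zero    = fromℕ _
prev (suc j) = inject₁ j

toℕ-next : (i : Fin (suc k)) → toℕ (next i) ≡ suc (toℕ i) % suc k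
toℕ-next {k} i = trans (toℕ-fromℕ< _) (cong (_% suc k) (+-comm (toℕ i) 1))

next-inject₁ : (j : Fin k) → next (inject₁ j) ≡ suc j
next-inject₁ {k} j = toℕ-injective (begin
  toℕ (next (inject₁ j))         ≡⟨ toℕ-next (inject₁ j) ⟩
  suc (toℕ (inject₁ j)) % suc k  ≡⟨ cong (λ x → suc x % suc k) (toℕ-inject₁ j) ⟩
  suc (toℕ j) % suc k            ≡⟨ m<n⇒m%n≡m (s≤s (toℕ<n j)) ⟩
  suc (toℕ j)                    ∎)
  where open ≡-Reasoning

next-fromℕ : next (fromℕ k) ≡ zero
next-fromℕ {k} = toℕ-injective (begin
  toℕ (next (fromℕ k))         ≡⟨ toℕ-next (fromℕ k) ⟩
  suc (toℕ (fromℕ k)) % suc k  ≡⟨ cong (λ x → suc x % suc k) (toℕ-fromℕ k) ⟩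
  suc k % suc k                ≡⟨ n%n≡0 (suc k) ⟩
  0                            ∎)
  where open ≡-Reasoning

next-prev : (v : Fin (suc k)) → next (prev v) ≡ v
next-prev zero    = next-fromℕ
next-prev (suc j) = next-inject₁ j

prev-next : (e : Fin (suc k)) → prev (next e) ≡ e
prev-next e with view e
... | ‵fromℕ     = cong prev next-fromℕ
... | ‵inject₁ j = cong prev (next-inject₁ j)

prev-≢ : (v : Fin (2 + n)) → prev v ≢ v
prev-≢ zero    ()
prev-≢ (suc j) eq = 1+n≢n (trans (sym (cong toℕ eq)) (toℕ-inject₁ j))

incident-cycle : (v e : Fin (suc k)) → (e ≡ v ⊎ next e ≡ v) ⇔ (e ≡ prev v ⊎ e ≡ v)
incident-cycle v e = mk⇔
  [ inj₂ , (λ next-e≡v → inj₁ (trans (sym (prev-next e)) (cong prev next-e≡v))) ]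
  [ (λ { refl → inj₂ (next-prev v) }) , inj₁ ]

vertexSum-cycle : (f : Labeling (2 + n)) (v : Fin (2 + n)) →
  vertexSum (cycle (2 + n)) f v ≡ label f (prev v) + label f v
vertexSum-cycle f v =
  sum-filter-pair (λ e → (e ≟ v) ⊎-dec (next e ≟ v)) (label f) (prev-≢ v) (incident-cycle v)

zigzag-incident-sum : (v : Fin (2 + n)) → toℕ (zigzag (prev v)) + toℕ (zigzag v) ∈[ n , 2 + n ]
zigzag-incident-sum {n} zero = subst (_∈[ n , 2 + n ]) (sym ends-sum) (n≤1+n n , n≤1+n (suc n))
  where
  open ≡-Reasoning
  ends-sum : toℕ (zigzag (fromℕ (suc n))) + toℕ (zigzag (zero {suc n})) ≡ suc n
  ends-sum = begin
    toℕ (zigzag (fromℕ (suc n))) + toℕ (zigzag (zero {suc n}))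
      ≡⟨ cong₂ _+_ (toℕ-zigzag (fromℕ (suc n))) (toℕ-zigzag (zero {suc n})) ⟩
    mirror (suc n) (toℕ (fromℕ (suc n))) + mirror (suc n) 0
      ≡⟨ cong (λ x → mirror (suc n) x + mirror (suc n) 0) (toℕ-fromℕ (suc n)) ⟩
    mirror (suc n) (suc n) + mirror (suc n) 0
      ≡⟨ mirror-ends (suc n) ⟩
    suc n ∎
zigzag-incident-sum {n} (suc j) =
  subst (_∈[ n , 2 + n ]) (sym adjacent-sum) (mirror-adjacent (toℕ≤pred[n] j))
  where
  adjacent-sum : toℕ (zigzag (inject₁ j)) + toℕ (zigzag (suc j)) ≡
                 mirror (suc n) (toℕ j) + mirror (suc n) (suc (toℕ j))
  adjacent-sum = cong₂ _+_
    (trans (toℕ-zigzag (inject₁ j)) (cong (mirror (suc n)) (toℕ-inject₁ j)))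
    (toℕ-zigzag (suc j))

zigzag-vertexSum : (v : Fin (2 + n)) →
  vertexSum (cycle (2 + n)) (zigzagLabeling (2 + n)) v ≡ 2 + (toℕ (zigzag (prev v)) + toℕ (zigzag v))
zigzag-vertexSum {n} v = trans (vertexSum-cycle (zigzagLabeling (2 + n)) v)
                               (cong suc (+-suc (toℕ (zigzag (prev v))) (toℕ (zigzag v))))

cycle-approxMagic : ∀ n → IsApproxMagic 2 (cycle (2 + n))
cycle-approxMagic n = f , vertexSums-∈[]⇒approxMagic (cycle (2 + n)) f window
  where
  f : Labeling (2 + n)
  f = zigzagLabeling (2 + n)
  window : ∀ v → vertexSum (cycle (2 + n)) f v ∈[ 2 + n , 2 + (2 + n) ]
  window v with lower , upper ← zigzag-incident-sum v rewrite zigzag-vertexSum v =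
    s≤s (s≤s lower) , s≤s (s≤s upper)

lemma2p2 : (m : ℕ) → m ≥ 3 → IsApproxMagic 2 (cycle m)
lemma2p2 (suc zero)          (s≤s ())
lemma2p2 (suc (suc zero))    (s≤s (s≤s ()))
lemma2p2 (suc (suc (suc n))) _ = cycle-approxMagic (suc n)
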